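{- Let $W$ be a non-empty set and let $\mathfrak{A}$ be a family of binary relations on $W$ closed under $\circ$, $\backslash$, $/$ and $\cap$. Suppose $\mathbf{1}_{\mathfrak{A}} \in \mathfrak{A}$ satisfies $\mathbf{1}_{\mathfrak{A}} \circ R = R \circ \mathbf{1}_{\mathfrak{A}} = R$ for every $R \in \mathfrak{A}$. Then for every $R \in \mathfrak{A}$ we have $\mathbf{1}_{\mathfrak{A}} \subseteq R$ if and only if $\delta \subseteq R$, where $\delta=\{(x,x)\mid x\in W\}$. In particular, $\delta \subseteq \mathbf{1}_{\mathfrak{A}}$.
   Context: For binary relations $R,S$ on $W$: $R\circ S=\{(x,z) \mid \exists y\in W\,((x,y)\in R \text{ and } (y,z)\in S)\}$; $R\backslash S=\{(y,z)\in W\times W \mid \forall x\in W\,((x,y)\in R\Rightarrow (x,z)\in S)\}$; $S/R=\{(x,y)\in W\times W \mid \forall z\in W\,((y,z)\in R\Rightarrow(x,z)\in S)\}$. -}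

module Defs where

open import Level using (Level; 0ℓ; suc)
open import Data.Product using (Σ; ∃; _×_; _,_)
open import Relation.Binary.Core using (Rel)
open import Relation.Binary.PropositionalEquality using (_≡_)

module _ {W : Set} where

  _∘ʳ_ : Rel W 0ℓ → Rel W 0ℓ → Rel W 0ℓ
  (R ∘ʳ S) x z = Σ W λ y → R x y × S y z

  _∖ʳ_ : Rel W 0ℓ → Rel W 0ℓ → Rel W 0ℓ
  (R ∖ʳ S) y z = ∀ x → R x y → S x z

  _/ʳ_ : Rel W 0ℓ → Rel W 0ℓ → Rel W 0ℓ
  (S /ʳ R) x y = ∀ z → R y z → S x z

  _∩ʳ_ : Rel W 0ℓ → Rel W 0ℓ → Rel W 0ℓ
  (R ∩ʳ S) x y = R x y × S x y

  δ : Rel W 0ℓ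
  δ x y = x ≡ y

  _⊆ʳ_ : Rel W 0ℓ → Rel W 0ℓ → Set
  R ⊆ʳ S = ∀ {x y} → R x y → S x y

  _≐_ : Rel W 0ℓ → Rel W 0ℓ → Set
  R ≐ S = (R ⊆ʳ S) × (S ⊆ʳ R)

record Closed {ℓ : Level} {W : Set} (𝔄 : Rel W 0ℓ → Set ℓ) : Set (suc 0ℓ Level.⊔ ℓ) where
  field
    ∘-closed : ∀ {R S} → 𝔄 R → 𝔄 S → 𝔄 (R ∘ʳ S)
    ∖-closed : ∀ {R S} → 𝔄 R → 𝔄 S → 𝔄 (R ∖ʳ S)
    /-closed : ∀ {R S} → 𝔄 R → 𝔄 S → 𝔄 (S /ʳ R)
    ∩-closed : ∀ {R S} → 𝔄 R → 𝔄 S → 𝔄 (R ∩ʳ S)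

{-# OPTIONS --safe #-}
module Submission where

-- A reflexive R absorbs the unit from the right, so 𝟏 ⊆ R∘𝟏 = R.  Conversely
-- the residual 𝟏\𝟏 is reflexive and lies in 𝟏∘(𝟏\𝟏): a pair (x,x) factors as
-- x 𝟏 y and y (𝟏\𝟏) x, and feeding x 𝟏 y into the residual gives x 𝟏 x.

open import Defs
open import Level using (Level; 0ℓ)
open import Data.Product using (_×_; _,_; proj₁; proj₂)
open import Function.Bundles using (_⇔_; mk⇔)
open import Relation.Binary.Core using (Rel)
open import Relation.Binary.PropositionalEquality using (refl)

module _ {W : Set} where

  δ⊆∖-self : (R : Rel W 0ℓ) → δ ⊆ʳ (R ∖ʳ R)
  δ⊆∖-self R refl _ r = r

  ∖-self⊆∘∖-self⇒reflexive : (U : Rel W 0ℓ) →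
    (U ∖ʳ U) ⊆ʳ (U ∘ʳ (U ∖ʳ U)) → δ ⊆ʳ U
  ∖-self⊆∘∖-self⇒reflexive U split {x} x≡y with split (δ⊆∖-self U x≡y)
  ... | _ , xUy , yU∖Ux = yU∖Ux x xUy

  reflexive⇒∘-absorbs : (R U : Rel W 0ℓ) → δ ⊆ʳ R → U ⊆ʳ (R ∘ʳ U)
  reflexive⇒∘-absorbs R U δ⊆R {x} xUy = x , δ⊆R refl , xUy

lemma2p4 : {ℓ : Level} (W : Set) → W → (𝔄 : Rel W 0ℓ → Set ℓ) → Closed 𝔄 →
    (𝟏 : Rel W 0ℓ) → 𝔄 𝟏 → (∀ R → 𝔄 R → ((𝟏 ∘ʳ R) ≐ R) × ((R ∘ʳ 𝟏) ≐ R)) →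
    (∀ R → 𝔄 R → ((𝟏 ⊆ʳ R) ⇔ (δ ⊆ʳ R))) × (δ ⊆ʳ 𝟏)
lemma2p4 W _ 𝔄 closed 𝟏 𝔄𝟏 unit = 𝟏⊆⇔δ⊆ , δ⊆𝟏
  where
  open Closed closed

  δ⊆𝟏 : δ ⊆ʳ 𝟏
  δ⊆𝟏 = ∖-self⊆∘∖-self⇒reflexive 𝟏
          (proj₂ (proj₁ (unit (𝟏 ∖ʳ 𝟏) (∖-closed 𝔄𝟏 𝔄𝟏))))

  𝟏⊆⇔δ⊆ : ∀ R → 𝔄 R → (𝟏 ⊆ʳ R) ⇔ (δ ⊆ʳ R)
  𝟏⊆⇔δ⊆ R 𝔄R = mk⇔ 𝟏⊆⇒δ⊆ δ⊆⇒𝟏⊆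
    where
    𝟏⊆⇒δ⊆ : 𝟏 ⊆ʳ R → δ ⊆ʳ R
    𝟏⊆⇒δ⊆ 𝟏⊆R x≡y = 𝟏⊆R (δ⊆𝟏 x≡y)

    δ⊆⇒𝟏⊆ : δ ⊆ʳ R → 𝟏 ⊆ʳ R
    δ⊆⇒𝟏⊆ δ⊆R x𝟏y = proj₁ (proj₂ (unit R 𝔄R)) (reflexive⇒∘-absorbs R 𝟏 δ⊆R x𝟏y)
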